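{- For $p, q \geq 1$, the complete weak bipartite hypergraph $\mathcal{K}_{p,q}$ satisfies \[ HM_1(\mathcal{K}_{p,q}) = \sum_{k=2}^{p+q} \sum_{i=1}^{k-1} \binom{p}{i} \binom{q}{k-i} \left[i \cdot 2^{p-1}(2^q - 1) + (k-i) \cdot 2^{q-1}(2^p - 1)\right]^2, \] \[ HM_2(\mathcal{K}_{p,q}) = \sum_{k=2}^{p+q} \sum_{i=1}^{k-1} \binom{p}{i} \binom{q}{k-i} \left[2^{p-1}(2^q - 1)\right]^{2i} \left[2^{q-1}(2^p - 1)\right]^{2(k-i)}. \]
   Context: A hypergraph $\mathcal{H}$ consists of a non-empty finite vertex set $V(\mathcal{H})$ and a set $E(\mathcal{H})$ of hyperedges, each a subset of $V(\mathcal{H})$ with at least two vertices. The degree $d_{\mathcal{H}}(v)$ is the number of hyperedges containing $v$. $HM_1(\mathcal{H}) = \sum_{e \in E(\mathcal{H})} \left[ \sum_{v \in e} d_{\mathcal{H}}(v) \right]^2$ and $HM_2(\mathcal{H}) = \sum_{e \in E(\mathcal{H})} \left[ \prod_{v \in e} d_{\mathcal{H}}(v) \right]^2$. The complete weak bipartite hypergraph $\mathcal{K}_{p,q}$ has vertex set $V_1 \cup V_2$ with $V_1, V_2$ disjoint, $|V_1| = p$, $|V_2| = q$, and as hyperedges all subsets of $V_1 \cup V_2$ containing at least one vertex of $V_1$ and at least one vertex of $V_2$. Binomial coefficients $\binom{a}{b}$ with $b > a$ are $0$. -}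

module Defs where

open import Data.Bool using (Bool; true; false; _∧_; _∨_)
open import Data.Nat using (ℕ; zero; suc; _+_; _*_; _∸_; _^_)
open import Data.Fin using (Fin; _↑ˡ_; _↑ʳ_)
open import Data.Fin.Subset using (Subset; inside; outside)
open import Data.List using (List; []; _∷_; _++_; map; upTo; allFin; filterᵇ; length)
open import Data.Nat.ListAction using (sum; product)
open import Data.Bool.ListAction using (any)
open import Data.Vec using (Vec; lookup; []; _∷_)

record Hypergraph : Set where
  constructor mkHypergraph
  field
    order : ℕ
    edges : List (Subset order)
open Hypergraph public

allSubsets : (n : ℕ) → List (Subset n)
allSubsets zero    = [] ∷ []
allSubsets (suc n) = map (inside ∷_) (allSubsets n) ++ map (outside ∷_) (allSubsets n)

_∈ᵇ_ : ∀ {n} → Fin n → Subset n → Bool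
v ∈ᵇ e = lookup e v

degree : (H : Hypergraph) → Fin (order H) → ℕ
degree H v = length (filterᵇ (v ∈ᵇ_) (edges H))

verticesOf : ∀ {n} → Subset n → List (Fin n)
verticesOf {n} e = filterᵇ (_∈ᵇ e) (allFin n)

HM₁ : Hypergraph → ℕ
HM₁ H = sum (map (λ e → (sum (map (degree H) (verticesOf e))) ^ 2) (edges H))

HM₂ : Hypergraph → ℕ
HM₂ H = sum (map (λ e → (product (map (degree H) (verticesOf e))) ^ 2) (edges H))

-- Complete weak bipartite hypergraph K_{p,q}: vertex set Fin (p + q), with
-- V₁ = {i ↑ˡ q | i : Fin p} (first p vertices) and V₂ = {p ↑ʳ j | j : Fin q};
-- hyperedges: all subsets meeting both V₁ and V₂.
meetsV₁ : (p q : ℕ) → Subset (p + q) → Bool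
meetsV₁ p q e = any (λ i → (i ↑ˡ q) ∈ᵇ e) (allFin p)

meetsV₂ : (p q : ℕ) → Subset (p + q) → Bool
meetsV₂ p q e = any (λ j → (p ↑ʳ j) ∈ᵇ e) (allFin q)

completeWeakBipartite : (p q : ℕ) → Hypergraph
completeWeakBipartite p q =
  mkHypergraph (p + q) (filterᵇ (λ e → meetsV₁ p q e ∧ meetsV₂ p q e) (allSubsets (p + q)))

-- Σ_{k=a}^{b} f k  (empty, i.e. 0, when b < a)
sumFromTo : ℕ → ℕ → (ℕ → ℕ) → ℕ
sumFromTo a b f = sum (map (λ j → f (a + j)) (upTo (suc b ∸ a)))

{-# OPTIONS --safe #-}
-- Every hyperedge of K_{p,q} splits as a ++ b with a ⊆ V₁ and b ⊆ V₂ both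
-- nonempty.  A vertex of V₁ lies in 2^(p-1) of the subsets a and the other
-- side b may be any of the 2^q - 1 nonempty subsets of V₂, so every vertex of
-- V₁ has degree 2^(p-1)(2^q - 1), and symmetrically for V₂.  The weight of a
-- hyperedge therefore depends only on i = |a| and j = |b|, there are
-- C(p,i) C(q,j) hyperedges of type (i,j), and grouping the sum over types by
-- k = i + j gives both formulas.
module Submission where

open import Defs
open import Data.Nat using (ℕ; _+_; _*_; _∸_; _^_; _≥_)
open import Data.Nat.Combinatorics using (_C_)
open import Data.Product using (_×_)
open import Relation.Binary.PropositionalEquality using (_≡_)

import Algebra.Properties.CommutativeSemigroup as CommutativeSemigroupProperties
open import Data.Bool using (Bool; true; false; _∧_)
open import Data.Bool.ListAction using (any; or)
open import Data.Fin using (Fin; zero; suc; _↑ˡ_; _↑ʳ_)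
open import Data.Fin.Subset using (Subset; inside; outside; ∣_∣)
open import Data.List
  using (List; []; _∷_; _++_; map; applyUpTo; upTo; tabulate; filterᵇ; length; allFin)
open import Data.List.Properties
  using (map-++; map-∘; map-cong; map-id; map-tabulate; map-upTo; length-map; length-++)
open import Data.Nat using (zero; suc; _≤_; _<_; z≤n; s≤s; z<s; s<s; _<ᵇ_)
open import Data.Nat.Combinatorics using (nCk+nC[k+1]≡[n+1]C[k+1]; k>n⇒nCk≡0)
open import Data.Nat.ListAction using (sum; product)
open import Data.Nat.ListAction.Properties using (sum-++; product-++)
open import Data.Nat.Properties
open import Data.Nat.Solver using (module +-*-Solver)
open import Data.Product using (_,_)
import Data.Vec as Vec
open import Data.Vec using ([]; _∷_)
open import Data.Vec.Properties using (lookup-++ˡ; lookup-++ʳ)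
open import Function using (_∘_; id; const)
open import Relation.Binary.PropositionalEquality
  using (refl; sym; trans; cong; cong₂; subst; module ≡-Reasoning)

open ≡-Reasoning
open CommutativeSemigroupProperties +-commutativeSemigroup using (interchange; x∙yz≈y∙xz)
open CommutativeSemigroupProperties *-commutativeSemigroup using (x∙yz≈xz∙y)

iverson : Bool → ℕ
iverson true  = 1
iverson false = 0

iverson-∧ : ∀ x y w → iverson (x ∧ y) * w ≡ iverson x * (iverson y * w)
iverson-∧ true  y w = sym (+-identityʳ _)
iverson-∧ false y w = refl

iverson-mono : ∀ {x y} → (x ≡ true → y ≡ true) → iverson y * iverson x ≡ iverson x
iverson-mono {false} {y} _ = *-zeroʳ (iverson y)
iverson-mono {true}  x⇒y rewrite x⇒y refl = refl

[x^i*y^j]^2≡x^[2i]*y^[2j] : ∀ x y i j → (x ^ i * y ^ j) ^ 2 ≡ x ^ (2 * i) * y ^ (2 * j)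
[x^i*y^j]^2≡x^[2i]*y^[2j] x y i j = begin
  (x ^ i * y ^ j) ^ 2       ≡⟨ square-distrib-* (x ^ i) (y ^ j) ⟩
  (x ^ i) ^ 2 * (y ^ j) ^ 2 ≡⟨ cong₂ _*_ (square-^ x i) (square-^ y j) ⟩
  x ^ (2 * i) * y ^ (2 * j) ∎
  where
  open +-*-Solver
  square-distrib-* : ∀ a b → (a * b) ^ 2 ≡ a ^ 2 * b ^ 2
  square-distrib-* = solve 2 (λ a b → (a :* b) :^ 2 := a :^ 2 :* b :^ 2) refl
  square-^ : ∀ a n → (a ^ n) ^ 2 ≡ a ^ (2 * n)
  square-^ a n = trans (^-*-assoc a n 2) (cong (a ^_) (*-comm n 2))

module _ {A : Set} where

  sum-map-*ˡ : ∀ c (f : A → ℕ) xs → sum (map (λ x → c * f x) xs) ≡ c * sum (map f xs)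
  sum-map-*ˡ c f []       = sym (*-zeroʳ c)
  sum-map-*ˡ c f (x ∷ xs) =
    trans (cong (c * f x +_) (sum-map-*ˡ c f xs)) (sym (*-distribˡ-+ c (f x) _))

  sum-map-*ʳ : ∀ c (f : A → ℕ) xs → sum (map (λ x → f x * c) xs) ≡ sum (map f xs) * c
  sum-map-*ʳ c f []       = refl
  sum-map-*ʳ c f (x ∷ xs) =
    trans (cong (f x * c +_) (sum-map-*ʳ c f xs)) (sym (*-distribʳ-+ c (f x) _))

  sum-map-const : ∀ c (xs : List A) → sum (map (const c) xs) ≡ length xs * c
  sum-map-const c []       = refl
  sum-map-const c (x ∷ xs) = cong (c +_) (sum-map-const c xs)

  product-map-const : ∀ c (xs : List A) → product (map (const c) xs) ≡ c ^ length xs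
  product-map-const c []       = refl
  product-map-const c (x ∷ xs) = cong (c *_) (product-map-const c xs)

  sum-map-filterᵇ : ∀ (P : A → Bool) (f : A → ℕ) xs →
    sum (map f (filterᵇ P xs)) ≡ sum (map (λ x → iverson (P x) * f x) xs)
  sum-map-filterᵇ P f []       = refl
  sum-map-filterᵇ P f (x ∷ xs) with P x
  ... | true  = cong₂ _+_ (sym (+-identityʳ (f x))) (sum-map-filterᵇ P f xs)
  ... | false = sum-map-filterᵇ P f xs

  length-filterᵇ : ∀ (P : A → Bool) xs → length (filterᵇ P xs) ≡ sum (map (iverson ∘ P) xs)
  length-filterᵇ P []       = refl
  length-filterᵇ P (x ∷ xs) with P x
  ... | true  = cong suc (length-filterᵇ P xs)
  ... | false = length-filterᵇ P xs

  any≡0<ᵇlength-filterᵇ : ∀ (P : A → Bool) xs → any P xs ≡ (0 <ᵇ length (filterᵇ P xs))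
  any≡0<ᵇlength-filterᵇ P []       = refl
  any≡0<ᵇlength-filterᵇ P (x ∷ xs) with P x
  ... | true  = refl
  ... | false = any≡0<ᵇlength-filterᵇ P xs

  any-cong : ∀ {P Q : A → Bool} → (∀ x → P x ≡ Q x) → ∀ xs → any P xs ≡ any Q xs
  any-cong P≗Q xs = cong or (map-cong P≗Q xs)

  filterᵇ-map : ∀ {B : Set} (P : B → Bool) (f : A → B) xs →
    filterᵇ P (map f xs) ≡ map f (filterᵇ (P ∘ f) xs)
  filterᵇ-map P f []       = refl
  filterᵇ-map P f (x ∷ xs) with P (f x)
  ... | true  = cong (f x ∷_) (filterᵇ-map P f xs)
  ... | false = filterᵇ-map P f xs

-- Sums over ranges

sumUpTo : ℕ → (ℕ → ℕ) → ℕ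
sumUpTo n f = sum (applyUpTo f n)

syntax sumUpTo n (λ i → e) = ∑[ i < n ] e

sumFromTo≡sumUpTo : ∀ a b f → sumFromTo a b f ≡ ∑[ j < suc b ∸ a ] f (a + j)
sumFromTo≡sumUpTo a b f = cong sum (map-upTo (λ j → f (a + j)) (suc b ∸ a))

sumFromTo-cong : ∀ a b {f g : ℕ → ℕ} → (∀ k → f k ≡ g k) →
  sumFromTo a b f ≡ sumFromTo a b g
sumFromTo-cong a b f≗g = cong sum (map-cong (λ j → f≗g (a + j)) (upTo (suc b ∸ a)))

sumUpTo-cong : ∀ n {f g : ℕ → ℕ} → (∀ i → i < n → f i ≡ g i) → sumUpTo n f ≡ sumUpTo n g
sumUpTo-cong zero    f≗g = refl
sumUpTo-cong (suc n) f≗g =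
  cong₂ _+_ (f≗g 0 z<s) (sumUpTo-cong n (λ i i<n → f≗g (suc i) (s<s i<n)))

sumUpTo-+ : ∀ n (f g : ℕ → ℕ) → ∑[ i < n ] (f i + g i) ≡ sumUpTo n f + sumUpTo n g
sumUpTo-+ zero    f g = refl
sumUpTo-+ (suc n) f g =
  trans (cong (f 0 + g 0 +_) (sumUpTo-+ n (f ∘ suc) (g ∘ suc))) (interchange (f 0) (g 0) _ _)

sumUpTo-*ˡ : ∀ n c (f : ℕ → ℕ) → ∑[ i < n ] (c * f i) ≡ c * sumUpTo n f
sumUpTo-*ˡ zero    c f = sym (*-zeroʳ c)
sumUpTo-*ˡ (suc n) c f =
  trans (cong (c * f 0 +_) (sumUpTo-*ˡ n c (f ∘ suc))) (sym (*-distribˡ-+ c (f 0) _))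

sumUpTo-vanishing : ∀ {n N} {f : ℕ → ℕ} → n ≤ N → (∀ i → n ≤ i → f i ≡ 0) →
  sumUpTo N f ≡ sumUpTo n f
sumUpTo-vanishing {zero}  {zero}  _         _ = refl
sumUpTo-vanishing {zero}  {suc N} _         f≡0 =
  cong₂ _+_ (f≡0 0 z≤n) (sumUpTo-vanishing {N = N} z≤n (λ i _ → f≡0 (suc i) z≤n))
sumUpTo-vanishing {suc n} {suc N} (s≤s n≤N) f≡0 =
  cong (_ +_) (sumUpTo-vanishing n≤N (λ i n≤i → f≡0 (suc i) (s≤s n≤i)))

sumUpTo-antidiagonals : ∀ N (g : ℕ → ℕ → ℕ) →
  ∑[ k < N ] ∑[ i < suc k ] g i (k ∸ i) ≡ ∑[ i < N ] sumUpTo (N ∸ i) (g i)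
sumUpTo-antidiagonals zero    g = refl
sumUpTo-antidiagonals (suc N) g = begin
  (g 0 0 + 0) + ∑[ k < N ] (g 0 (suc k) + ∑[ i < suc k ] g (suc i) (k ∸ i))
    ≡⟨ cong₂ _+_ (+-identityʳ (g 0 0)) (sumUpTo-+ N _ _) ⟩
  g 0 0 + (∑[ k < N ] g 0 (suc k) + ∑[ k < N ] ∑[ i < suc k ] g (suc i) (k ∸ i))
    ≡⟨ sym (+-assoc (g 0 0) _ _) ⟩
  sumUpTo (suc N) (g 0) + ∑[ k < N ] ∑[ i < suc k ] g (suc i) (k ∸ i)
    ≡⟨ cong (sumUpTo (suc N) (g 0) +_) (sumUpTo-antidiagonals N (g ∘ suc)) ⟩
  sumUpTo (suc N) (g 0) + ∑[ i < N ] sumUpTo (N ∸ i) (g (suc i)) ∎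

sumUpTo-antidiagonals-box : ∀ m n (g : ℕ → ℕ → ℕ) →
  (∀ i j → m < i → g i j ≡ 0) → (∀ i j → n < j → g i j ≡ 0) →
  ∑[ k < m + suc n ] ∑[ i < suc k ] g i (k ∸ i) ≡ ∑[ i < suc m ] sumUpTo (suc n) (g i)
sumUpTo-antidiagonals-box m n g g≡0-below g≡0-right = begin
  ∑[ k < m + suc n ] ∑[ i < suc k ] g i (k ∸ i)
    ≡⟨ sumUpTo-antidiagonals (m + suc n) g ⟩
  ∑[ i < m + suc n ] sumUpTo (m + suc n ∸ i) (g i)
    ≡⟨ sumUpTo-vanishing (m<m+n m z<s)
         (λ i m<i → sumUpTo-vanishing {N = m + suc n ∸ i} z≤n
                      (λ j _ → g≡0-below i j m<i)) ⟩
  ∑[ i < suc m ] sumUpTo (m + suc n ∸ i) (g i)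
    ≡⟨ sumUpTo-cong (suc m) (λ { i (s≤s i≤m) →
         sumUpTo-vanishing (row-fits i≤m) (λ j n<j → g≡0-right i j n<j) }) ⟩
  ∑[ i < suc m ] sumUpTo (suc n) (g i) ∎
  where
  row-fits : ∀ {i} → i ≤ m → suc n ≤ m + suc n ∸ i
  row-fits {i} i≤m = subst (suc n ≤_) (sym (+-∸-comm (suc n) i≤m)) (m≤n+m (suc n) (m ∸ i))

-- Sums over subsets

sumSubsets : (n : ℕ) → (Subset n → ℕ) → ℕ
sumSubsets n f = sum (map f (allSubsets n))

syntax sumSubsets n (λ a → e) = ∑[ a ⊆ n ] e

sumSubsets-suc : ∀ n (f : Subset (suc n) → ℕ) →
  sumSubsets (suc n) f ≡ ∑[ a ⊆ n ] f (inside ∷ a) + ∑[ a ⊆ n ] f (outside ∷ a)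
sumSubsets-suc n f = begin
  sum (map f (map (inside ∷_) as ++ map (outside ∷_) as))
    ≡⟨ cong sum (map-++ f (map (inside ∷_) as) _) ⟩
  sum (map f (map (inside ∷_) as) ++ map f (map (outside ∷_) as))
    ≡⟨ sum-++ (map f (map (inside ∷_) as)) _ ⟩
  sum (map f (map (inside ∷_) as)) + sum (map f (map (outside ∷_) as))
    ≡⟨ cong₂ _+_ (cong sum (sym (map-∘ as))) (cong sum (sym (map-∘ as))) ⟩
  ∑[ a ⊆ n ] f (inside ∷ a) + ∑[ a ⊆ n ] f (outside ∷ a) ∎
  where as = allSubsets n

sumSubsets-cong : ∀ n {f g : Subset n → ℕ} → (∀ a → f a ≡ g a) →
  sumSubsets n f ≡ sumSubsets n g
sumSubsets-cong n f≗g = cong sum (map-cong f≗g (allSubsets n))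

sumSubsets-++ : ∀ m n (f : Subset (m + n) → ℕ) →
  sumSubsets (m + n) f ≡ ∑[ a ⊆ m ] ∑[ b ⊆ n ] f (a Vec.++ b)
sumSubsets-++ zero    n f = sym (+-identityʳ _)
sumSubsets-++ (suc m) n f = begin
  sumSubsets (suc m + n) f
    ≡⟨ sumSubsets-suc (m + n) f ⟩
  ∑[ e ⊆ m + n ] f (inside ∷ e) + ∑[ e ⊆ m + n ] f (outside ∷ e)
    ≡⟨ cong₂ _+_ (sumSubsets-++ m n _) (sumSubsets-++ m n _) ⟩
  ∑[ a ⊆ m ] ∑[ b ⊆ n ] f (inside ∷ (a Vec.++ b))
    + ∑[ a ⊆ m ] ∑[ b ⊆ n ] f (outside ∷ (a Vec.++ b))
    ≡⟨ sumSubsets-suc m _ ⟨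
  ∑[ a ⊆ suc m ] ∑[ b ⊆ n ] f (a Vec.++ b) ∎

sumSubsets-*ˡ : ∀ n c (f : Subset n → ℕ) → ∑[ a ⊆ n ] (c * f a) ≡ c * sumSubsets n f
sumSubsets-*ˡ n c f = sum-map-*ˡ c f (allSubsets n)

sumSubsets-separable : ∀ m n (f : Subset m → ℕ) (g : Subset n → ℕ) →
  ∑[ a ⊆ m ] ∑[ b ⊆ n ] (f a * g b) ≡ sumSubsets m f * sumSubsets n g
sumSubsets-separable m n f g =
  trans (sumSubsets-cong m (λ a → sumSubsets-*ˡ n (f a) g)) (sum-map-*ʳ _ f (allSubsets m))

length-allSubsets : ∀ n → length (allSubsets n) ≡ 2 ^ n
length-allSubsets zero    = refl
length-allSubsets (suc n) = begin
  length (map (inside ∷_) as ++ map (outside ∷_) as)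
    ≡⟨ length-++ (map (inside ∷_) as) ⟩
  length (map (inside ∷_) as) + length (map (outside ∷_) as)
    ≡⟨ cong₂ _+_ (length-map _ as) (length-map _ as) ⟩
  length as + length as
    ≡⟨ cong₂ _+_ (length-allSubsets n) (trans (length-allSubsets n) (sym (+-identityʳ _))) ⟩
  2 ^ suc n ∎
  where as = allSubsets n

sumSubsets-const : ∀ n c → ∑[ a ⊆ n ] c ≡ 2 ^ n * c
sumSubsets-const n c =
  trans (sum-map-const c (allSubsets n)) (cong (_* c) (length-allSubsets n))

nonempty : ∀ {n} → Subset n → Bool
nonempty a = 0 <ᵇ ∣ a ∣

∈ᵇ⇒nonempty : ∀ {n} {i : Fin n} (a : Subset n) → i ∈ᵇ a ≡ true → nonempty a ≡ true
∈ᵇ⇒nonempty {i = zero}  (true  ∷ a) _   = refl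
∈ᵇ⇒nonempty {i = zero}  (false ∷ a) ()
∈ᵇ⇒nonempty {i = suc i} (true  ∷ a) _   = refl
∈ᵇ⇒nonempty {i = suc i} (false ∷ a) i∈a = ∈ᵇ⇒nonempty a i∈a

sumSubsets-∈ᵇ : ∀ {n} (i : Fin n) → ∑[ a ⊆ n ] iverson (i ∈ᵇ a) ≡ 2 ^ (n ∸ 1)
sumSubsets-∈ᵇ {suc n} zero = begin
  ∑[ a ⊆ suc n ] iverson (zero ∈ᵇ a) ≡⟨ sumSubsets-suc n _ ⟩
  ∑[ a ⊆ n ] 1 + ∑[ a ⊆ n ] 0        ≡⟨ cong₂ _+_ (sumSubsets-const n 1) (sumSubsets-const n 0) ⟩
  2 ^ n * 1 + 2 ^ n * 0              ≡⟨ cong₂ _+_ (*-identityʳ (2 ^ n)) (*-zeroʳ (2 ^ n)) ⟩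
  2 ^ n + 0                          ≡⟨ +-identityʳ (2 ^ n) ⟩
  2 ^ n                              ∎
sumSubsets-∈ᵇ {suc (suc n)} (suc i) = begin
  ∑[ a ⊆ suc (suc n) ] iverson (suc i ∈ᵇ a)   ≡⟨ sumSubsets-suc (suc n) _ ⟩
  ∑[ a ⊆ suc n ] iverson (i ∈ᵇ a) + ∑[ a ⊆ suc n ] iverson (i ∈ᵇ a)
    ≡⟨ cong₂ _+_ (sumSubsets-∈ᵇ i) (trans (sumSubsets-∈ᵇ i) (sym (+-identityʳ (2 ^ n)))) ⟩
  2 ^ suc n                                   ∎

sumSubsets-nonempty : ∀ n → ∑[ a ⊆ n ] iverson (nonempty a) ≡ 2 ^ n ∸ 1
sumSubsets-nonempty zero    = refl
sumSubsets-nonempty (suc n) = begin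
  ∑[ a ⊆ suc n ] iverson (nonempty a)
    ≡⟨ sumSubsets-suc n _ ⟩
  ∑[ a ⊆ n ] 1 + ∑[ a ⊆ n ] iverson (nonempty a)
    ≡⟨ cong₂ _+_ (trans (sumSubsets-const n 1) (*-identityʳ (2 ^ n))) (sumSubsets-nonempty n) ⟩
  2 ^ n + (2 ^ n ∸ 1)
    ≡⟨ +-∸-assoc (2 ^ n) (m^n>0 2 n) ⟨
  2 ^ n + 2 ^ n ∸ 1
    ≡⟨ cong (λ x → 2 ^ n + x ∸ 1) (+-identityʳ (2 ^ n)) ⟨
  2 ^ suc n ∸ 1 ∎

-- The range is any N > n rather than exactly suc n, so that Pascal's rule
-- closes the induction without a boundary term.
sumSubsets-∣∣ : ∀ n {N} (h : ℕ → ℕ) → n < N →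
  ∑[ a ⊆ n ] h ∣ a ∣ ≡ ∑[ i < N ] ((n C i) * h i)
sumSubsets-∣∣ zero    {suc N} h _ = sym (begin
  1 * h 0 + ∑[ i < N ] ((0 C suc i) * h (suc i))
    ≡⟨ cong (1 * h 0 +_) (sumUpTo-vanishing {N = N} z≤n (λ _ _ → refl)) ⟩
  1 * h 0 + 0
    ≡⟨ cong (_+ 0) (*-identityˡ (h 0)) ⟩
  h 0 + 0 ∎)
sumSubsets-∣∣ (suc n) {suc N} h (s≤s n<N) = begin
  ∑[ a ⊆ suc n ] h ∣ a ∣
    ≡⟨ sumSubsets-suc n _ ⟩
  ∑[ a ⊆ n ] h (suc ∣ a ∣) + ∑[ a ⊆ n ] h ∣ a ∣
    ≡⟨ cong₂ _+_ (sumSubsets-∣∣ n (h ∘ suc) n<N) (sumSubsets-∣∣ n h (m<n⇒m<1+n n<N)) ⟩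
  ∑[ i < N ] ((n C i) * h (suc i)) + (h₀ + ∑[ i < N ] ((n C suc i) * h (suc i)))
    ≡⟨ x∙yz≈y∙xz (∑[ i < N ] ((n C i) * h (suc i))) h₀ _ ⟩
  h₀ + (∑[ i < N ] ((n C i) * h (suc i)) + ∑[ i < N ] ((n C suc i) * h (suc i)))
    ≡⟨ cong (h₀ +_) (sumUpTo-+ N _ _) ⟨
  h₀ + ∑[ i < N ] ((n C i) * h (suc i) + (n C suc i) * h (suc i))
    ≡⟨ cong (h₀ +_) (sumUpTo-cong N (λ i _ → pascal i)) ⟩
  ∑[ i < suc N ] ((suc n C i) * h i) ∎
  where
  h₀ = (n C 0) * h 0
  pascal : ∀ i → (n C i) * h (suc i) + (n C suc i) * h (suc i) ≡ (suc n C suc i) * h (suc i)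
  pascal i = trans (sym (*-distribʳ-+ (h (suc i)) (n C i) _))
                   (cong (_* h (suc i)) (nCk+nC[k+1]≡[n+1]C[k+1] n i))

sumSubsets-nonempty-∣∣ : ∀ n (h : ℕ → ℕ) →
  ∑[ a ⊆ n ] (iverson (nonempty a) * h ∣ a ∣) ≡ ∑[ i < n ] ((n C suc i) * h (suc i))
sumSubsets-nonempty-∣∣ n h = begin
  ∑[ a ⊆ n ] (iverson (nonempty a) * h ∣ a ∣)
    ≡⟨ sumSubsets-∣∣ n (λ i → iverson (0 <ᵇ i) * h i) (n<1+n n) ⟩
  (n C 0) * 0 + ∑[ i < n ] ((n C suc i) * (1 * h (suc i)))
    ≡⟨ cong₂ _+_ (*-zeroʳ (n C 0))
                 (sumUpTo-cong n (λ i _ → cong ((n C suc i) *_) (*-identityˡ _))) ⟩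
  ∑[ i < n ] ((n C suc i) * h (suc i)) ∎

-- Vertices of a hyperedge

verticesOf-suc : ∀ {n} x (e : Subset n) →
  filterᵇ (_∈ᵇ (x ∷ e)) (tabulate suc) ≡ map suc (verticesOf e)
verticesOf-suc {n} x e =
  trans (cong (filterᵇ (_∈ᵇ (x ∷ e))) (sym (map-tabulate id suc)))
        (filterᵇ-map (_∈ᵇ (x ∷ e)) suc (allFin n))

verticesOf-inside : ∀ {n} (e : Subset n) →
  verticesOf (inside ∷ e) ≡ zero ∷ map suc (verticesOf e)
verticesOf-inside e = cong (zero ∷_) (verticesOf-suc inside e)

verticesOf-outside : ∀ {n} (e : Subset n) →
  verticesOf (outside ∷ e) ≡ map suc (verticesOf e)
verticesOf-outside e = verticesOf-suc outside e

length-verticesOf : ∀ {n} (e : Subset n) → length (verticesOf e) ≡ ∣ e ∣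
length-verticesOf []          = refl
length-verticesOf (true  ∷ e) = trans (cong length (verticesOf-inside e))
  (cong suc (trans (length-map suc (verticesOf e)) (length-verticesOf e)))
length-verticesOf (false ∷ e) = trans (cong length (verticesOf-outside e))
  (trans (length-map suc (verticesOf e)) (length-verticesOf e))

any-∈ᵇ : ∀ {n} (e : Subset n) → any (_∈ᵇ e) (allFin n) ≡ nonempty e
any-∈ᵇ {n} e =
  trans (any≡0<ᵇlength-filterᵇ (_∈ᵇ e) (allFin n)) (cong (0 <ᵇ_) (length-verticesOf e))

verticesOf-++ : ∀ {m n} (a : Subset m) (b : Subset n) →
  verticesOf (a Vec.++ b) ≡ map (_↑ˡ n) (verticesOf a) ++ map (m ↑ʳ_) (verticesOf b)

map-suc-verticesOf-++ : ∀ {m n} (a : Subset m) (b : Subset n) →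
  map suc (verticesOf (a Vec.++ b))
    ≡ map (_↑ˡ n) (map suc (verticesOf a)) ++ map (suc m ↑ʳ_) (verticesOf b)
map-suc-verticesOf-++ {m} {n} a b = begin
  map suc (verticesOf (a Vec.++ b))
    ≡⟨ cong (map suc) (verticesOf-++ a b) ⟩
  map suc (map (_↑ˡ n) va ++ map (m ↑ʳ_) vb)
    ≡⟨ map-++ suc (map (_↑ˡ n) va) _ ⟩
  map suc (map (_↑ˡ n) va) ++ map suc (map (m ↑ʳ_) vb)
    ≡⟨ cong₂ _++_ (trans (sym (map-∘ va)) (map-∘ va)) (sym (map-∘ vb)) ⟩
  map (_↑ˡ n) (map suc va) ++ map (suc m ↑ʳ_) vb ∎
  where va = verticesOf a; vb = verticesOf b

verticesOf-++ [] b = sym (map-id (verticesOf b))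
verticesOf-++ {suc m} {n} (true ∷ a) b = begin
  verticesOf (inside ∷ (a Vec.++ b))
    ≡⟨ verticesOf-inside (a Vec.++ b) ⟩
  zero ∷ map suc (verticesOf (a Vec.++ b))
    ≡⟨ cong (zero ∷_) (map-suc-verticesOf-++ a b) ⟩
  zero ∷ (map (_↑ˡ n) (map suc (verticesOf a)) ++ map (suc m ↑ʳ_) (verticesOf b))
    ≡⟨ cong (λ vs → map (_↑ˡ n) vs ++ map (suc m ↑ʳ_) (verticesOf b)) (verticesOf-inside a) ⟨
  map (_↑ˡ n) (verticesOf (inside ∷ a)) ++ map (suc m ↑ʳ_) (verticesOf b) ∎
verticesOf-++ {suc m} {n} (false ∷ a) b = begin
  verticesOf (outside ∷ (a Vec.++ b))
    ≡⟨ verticesOf-outside (a Vec.++ b) ⟩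
  map suc (verticesOf (a Vec.++ b))
    ≡⟨ map-suc-verticesOf-++ a b ⟩
  map (_↑ˡ n) (map suc (verticesOf a)) ++ map (suc m ↑ʳ_) (verticesOf b)
    ≡⟨ cong (λ vs → map (_↑ˡ n) vs ++ map (suc m ↑ʳ_) (verticesOf b)) (verticesOf-outside a) ⟨
  map (_↑ˡ n) (verticesOf (outside ∷ a)) ++ map (suc m ↑ʳ_) (verticesOf b) ∎

module _ {m n} {f : Fin (m + n) → ℕ} {c d : ℕ}
         (f≡c : ∀ i → f (i ↑ˡ n) ≡ c) (f≡d : ∀ j → f (m ↑ʳ j) ≡ d)
         (a : Subset m) (b : Subset n) where

  map-verticesOf-++ :
    map f (verticesOf (a Vec.++ b)) ≡ map (const c) (verticesOf a) ++ map (const d) (verticesOf b)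
  map-verticesOf-++ = begin
    map f (verticesOf (a Vec.++ b))
      ≡⟨ cong (map f) (verticesOf-++ a b) ⟩
    map f (map (_↑ˡ n) va ++ map (m ↑ʳ_) vb)
      ≡⟨ map-++ f (map (_↑ˡ n) va) _ ⟩
    map f (map (_↑ˡ n) va) ++ map f (map (m ↑ʳ_) vb)
      ≡⟨ cong₂ _++_ (trans (sym (map-∘ va)) (map-cong f≡c va))
                    (trans (sym (map-∘ vb)) (map-cong f≡d vb)) ⟩
    map (const c) va ++ map (const d) vb ∎
    where va = verticesOf a; vb = verticesOf b

  sum-map-verticesOf-++ : sum (map f (verticesOf (a Vec.++ b))) ≡ ∣ a ∣ * c + ∣ b ∣ * d
  sum-map-verticesOf-++ = begin
    sum (map f (verticesOf (a Vec.++ b)))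
      ≡⟨ cong sum map-verticesOf-++ ⟩
    sum (map (const c) (verticesOf a) ++ map (const d) (verticesOf b))
      ≡⟨ sum-++ (map (const c) (verticesOf a)) _ ⟩
    sum (map (const c) (verticesOf a)) + sum (map (const d) (verticesOf b))
      ≡⟨ cong₂ _+_ (sum-map-const c (verticesOf a)) (sum-map-const d (verticesOf b)) ⟩
    length (verticesOf a) * c + length (verticesOf b) * d
      ≡⟨ cong₂ (λ k l → k * c + l * d) (length-verticesOf a) (length-verticesOf b) ⟩
    ∣ a ∣ * c + ∣ b ∣ * d ∎

  product-map-verticesOf-++ :
    product (map f (verticesOf (a Vec.++ b))) ≡ c ^ ∣ a ∣ * d ^ ∣ b ∣
  product-map-verticesOf-++ = begin
    product (map f (verticesOf (a Vec.++ b)))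
      ≡⟨ cong product map-verticesOf-++ ⟩
    product (map (const c) (verticesOf a) ++ map (const d) (verticesOf b))
      ≡⟨ product-++ (map (const c) (verticesOf a)) _ ⟩
    product (map (const c) (verticesOf a)) * product (map (const d) (verticesOf b))
      ≡⟨ cong₂ _*_ (product-map-const c (verticesOf a)) (product-map-const d (verticesOf b)) ⟩
    c ^ length (verticesOf a) * d ^ length (verticesOf b)
      ≡⟨ cong₂ (λ k l → c ^ k * d ^ l) (length-verticesOf a) (length-verticesOf b) ⟩
    c ^ ∣ a ∣ * d ^ ∣ b ∣ ∎

-- The complete weak bipartite hypergraph

meetsV₁-++ : ∀ {p q} (a : Subset p) (b : Subset q) → meetsV₁ p q (a Vec.++ b) ≡ nonempty a
meetsV₁-++ {p} a b = trans (any-cong (lookup-++ˡ a b) (allFin p)) (any-∈ᵇ a)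

meetsV₂-++ : ∀ {p q} (a : Subset p) (b : Subset q) → meetsV₂ p q (a Vec.++ b) ≡ nonempty b
meetsV₂-++ {q = q} a b = trans (any-cong (lookup-++ʳ a b) (allFin q)) (any-∈ᵇ b)

sum-map-edges : ∀ {p q} (W : Subset (p + q) → ℕ) →
  sum (map W (edges (completeWeakBipartite p q)))
    ≡ ∑[ a ⊆ p ] ∑[ b ⊆ q ] (iverson (nonempty a) * (iverson (nonempty b) * W (a Vec.++ b)))
sum-map-edges {p} {q} W = begin
  sum (map W (filterᵇ meetsBoth (allSubsets (p + q))))
    ≡⟨ sum-map-filterᵇ meetsBoth W (allSubsets (p + q)) ⟩
  ∑[ e ⊆ p + q ] (iverson (meetsBoth e) * W e)
    ≡⟨ sumSubsets-++ p q _ ⟩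
  ∑[ a ⊆ p ] ∑[ b ⊆ q ] (iverson (meetsBoth (a Vec.++ b)) * W (a Vec.++ b))
    ≡⟨ sumSubsets-cong p (λ a → sumSubsets-cong q (λ b →
         trans (cong (λ x → iverson x * W (a Vec.++ b))
                     (cong₂ _∧_ (meetsV₁-++ a b) (meetsV₂-++ a b)))
               (iverson-∧ (nonempty a) (nonempty b) _))) ⟩
  ∑[ a ⊆ p ] ∑[ b ⊆ q ] (iverson (nonempty a) * (iverson (nonempty b) * W (a Vec.++ b))) ∎
  where
  meetsBoth : Subset (p + q) → Bool
  meetsBoth e = meetsV₁ p q e ∧ meetsV₂ p q e

degree-completeWeakBipartite : ∀ {p q} (v : Fin (p + q)) →
  degree (completeWeakBipartite p q) v
    ≡ ∑[ a ⊆ p ] ∑[ b ⊆ q ]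
        (iverson (nonempty a) * (iverson (nonempty b) * iverson (v ∈ᵇ (a Vec.++ b))))
degree-completeWeakBipartite {p} {q} v =
  trans (length-filterᵇ (v ∈ᵇ_) (edges (completeWeakBipartite p q)))
        (sum-map-edges {p} {q} (λ e → iverson (v ∈ᵇ e)))

partDegree : ℕ → ℕ → ℕ
partDegree p q = 2 ^ (p ∸ 1) * (2 ^ q ∸ 1)

degree-↑ˡ : ∀ {p q} (i : Fin p) → degree (completeWeakBipartite p q) (i ↑ˡ q) ≡ partDegree p q
degree-↑ˡ {p} {q} i = begin
  degree (completeWeakBipartite p q) (i ↑ˡ q)
    ≡⟨ degree-completeWeakBipartite {p} (i ↑ˡ q) ⟩
  ∑[ a ⊆ p ] ∑[ b ⊆ q ]
    (iverson (nonempty a) * (iverson (nonempty b) * iverson ((i ↑ˡ q) ∈ᵇ (a Vec.++ b))))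
    ≡⟨ sumSubsets-cong p (λ a → sumSubsets-cong q (λ b → incidence a b)) ⟩
  ∑[ a ⊆ p ] ∑[ b ⊆ q ] (iverson (i ∈ᵇ a) * iverson (nonempty b))
    ≡⟨ sumSubsets-separable p q _ _ ⟩
  ∑[ a ⊆ p ] iverson (i ∈ᵇ a) * ∑[ b ⊆ q ] iverson (nonempty b)
    ≡⟨ cong₂ _*_ (sumSubsets-∈ᵇ i) (sumSubsets-nonempty q) ⟩
  partDegree p q ∎
  where
  incidence : ∀ a b →
    iverson (nonempty a) * (iverson (nonempty b) * iverson ((i ↑ˡ q) ∈ᵇ (a Vec.++ b)))
      ≡ iverson (i ∈ᵇ a) * iverson (nonempty b)
  incidence a b = begin
    iverson (nonempty a) * (iverson (nonempty b) * iverson ((i ↑ˡ q) ∈ᵇ (a Vec.++ b)))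
      ≡⟨ cong (λ x → iverson (nonempty a) * (iverson (nonempty b) * iverson x))
              (lookup-++ˡ a b i) ⟩
    iverson (nonempty a) * (iverson (nonempty b) * iverson (i ∈ᵇ a))
      ≡⟨ x∙yz≈xz∙y (iverson (nonempty a)) _ _ ⟩
    iverson (nonempty a) * iverson (i ∈ᵇ a) * iverson (nonempty b)
      ≡⟨ cong (_* iverson (nonempty b)) (iverson-mono (∈ᵇ⇒nonempty a)) ⟩
    iverson (i ∈ᵇ a) * iverson (nonempty b) ∎

degree-↑ʳ : ∀ {p q} (j : Fin q) → degree (completeWeakBipartite p q) (p ↑ʳ j) ≡ partDegree q p
degree-↑ʳ {p} {q} j = begin
  degree (completeWeakBipartite p q) (p ↑ʳ j)
    ≡⟨ degree-completeWeakBipartite {p} (p ↑ʳ j) ⟩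
  ∑[ a ⊆ p ] ∑[ b ⊆ q ]
    (iverson (nonempty a) * (iverson (nonempty b) * iverson ((p ↑ʳ j) ∈ᵇ (a Vec.++ b))))
    ≡⟨ sumSubsets-cong p (λ a → sumSubsets-cong q (λ b →
         cong (iverson (nonempty a) *_) (incidence a b))) ⟩
  ∑[ a ⊆ p ] ∑[ b ⊆ q ] (iverson (nonempty a) * iverson (j ∈ᵇ b))
    ≡⟨ sumSubsets-separable p q _ _ ⟩
  ∑[ a ⊆ p ] iverson (nonempty a) * ∑[ b ⊆ q ] iverson (j ∈ᵇ b)
    ≡⟨ cong₂ _*_ (sumSubsets-nonempty p) (sumSubsets-∈ᵇ j) ⟩
  (2 ^ p ∸ 1) * 2 ^ (q ∸ 1)
    ≡⟨ *-comm (2 ^ p ∸ 1) _ ⟩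
  partDegree q p ∎
  where
  incidence : ∀ a b →
    iverson (nonempty b) * iverson ((p ↑ʳ j) ∈ᵇ (a Vec.++ b)) ≡ iverson (j ∈ᵇ b)
  incidence a b = trans (cong (λ x → iverson (nonempty b) * iverson x) (lookup-++ʳ a b j))
                        (iverson-mono (∈ᵇ⇒nonempty b))

-- Summand (i, j) accounts for the C(p, i + 1) C(q, j + 1) hyperedges a ++ b
-- with ∣ a ∣ = i + 1 and ∣ b ∣ = j + 1.
edgeTypeSum : ℕ → ℕ → (ℕ → ℕ → ℕ) → ℕ
edgeTypeSum p q F = ∑[ i < p ] ∑[ j < q ] ((p C suc i) * ((q C suc j) * F (suc i) (suc j)))

sum-map-edges-by-type : ∀ {p q} {W : Subset (p + q) → ℕ} (F : ℕ → ℕ → ℕ) →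
  (∀ a b → W (a Vec.++ b) ≡ F ∣ a ∣ ∣ b ∣) →
  sum (map W (edges (completeWeakBipartite p q))) ≡ edgeTypeSum p q F
sum-map-edges-by-type {p} {q} {W} F W≡F = begin
  sum (map W (edges (completeWeakBipartite p q)))
    ≡⟨ sum-map-edges {p} {q} W ⟩
  ∑[ a ⊆ p ] ∑[ b ⊆ q ] (iverson (nonempty a) * (iverson (nonempty b) * W (a Vec.++ b)))
    ≡⟨ sumSubsets-cong p (λ a → trans (sumSubsets-*ˡ q (iverson (nonempty a)) _)
                                      (cong (iverson (nonempty a) *_) (row a))) ⟩
  ∑[ a ⊆ p ] (iverson (nonempty a) * rowSum ∣ a ∣)
    ≡⟨ sumSubsets-nonempty-∣∣ p rowSum ⟩
  ∑[ i < p ] ((p C suc i) * rowSum (suc i))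
    ≡⟨ sumUpTo-cong p (λ i _ → sumUpTo-*ˡ q (p C suc i) _) ⟨
  edgeTypeSum p q F ∎
  where
  rowSum : ℕ → ℕ
  rowSum i = ∑[ j < q ] ((q C suc j) * F i (suc j))
  row : ∀ a → ∑[ b ⊆ q ] (iverson (nonempty b) * W (a Vec.++ b)) ≡ rowSum ∣ a ∣
  row a = trans (sumSubsets-cong q (λ b → cong (iverson (nonempty b) *_) (W≡F a b)))
                (sumSubsets-nonempty-∣∣ q (F ∣ a ∣))

edgeTypeSum-antidiagonals : ∀ m n (F : ℕ → ℕ → ℕ) →
  edgeTypeSum (suc m) (suc n) F
    ≡ sumFromTo 2 (suc m + suc n) (λ k → sumFromTo 1 (k ∸ 1) (λ i →
        (suc m C i) * (suc n C (k ∸ i)) * F i (k ∸ i)))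
edgeTypeSum-antidiagonals m n F = begin
  edgeTypeSum (suc m) (suc n) F
    ≡⟨ sumUpTo-antidiagonals-box m n g g≡0-below g≡0-right ⟨
  ∑[ k < m + suc n ] ∑[ i < suc k ] g i (k ∸ i)
    ≡⟨ sumUpTo-cong (m + suc n) (λ k _ →
         sumUpTo-cong (suc k) (λ { i (s≤s i≤k) → entry i≤k })) ⟩
  ∑[ k < m + suc n ] ∑[ i < suc k ] T (2 + k) (1 + i)
    ≡⟨ sumUpTo-cong (m + suc n) (λ k _ → sumFromTo≡sumUpTo 1 (suc k) (T (2 + k))) ⟨
  ∑[ k < m + suc n ] sumFromTo 1 (suc k) (T (2 + k))
    ≡⟨ sumFromTo≡sumUpTo 2 (suc m + suc n) (λ k → sumFromTo 1 (k ∸ 1) (T k)) ⟨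
  sumFromTo 2 (suc m + suc n) (λ k → sumFromTo 1 (k ∸ 1) (T k)) ∎
  where
  g : ℕ → ℕ → ℕ
  g i j = (suc m C suc i) * ((suc n C suc j) * F (suc i) (suc j))
  T : ℕ → ℕ → ℕ
  T k i = (suc m C i) * (suc n C (k ∸ i)) * F i (k ∸ i)
  g≡0-below : ∀ i j → m < i → g i j ≡ 0
  g≡0-below i j m<i = cong (_* _) (k>n⇒nCk≡0 (s<s m<i))
  g≡0-right : ∀ i j → n < j → g i j ≡ 0
  g≡0-right i j n<j =
    trans (cong (λ c → (suc m C suc i) * (c * F (suc i) (suc j))) (k>n⇒nCk≡0 (s<s n<j)))
          (*-zeroʳ (suc m C suc i))
  entry : ∀ {i k} → i ≤ k → g i (k ∸ i) ≡ T (2 + k) (1 + i)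
  entry {i} {k} i≤k = trans (sym (*-assoc (suc m C suc i) (suc n C suc (k ∸ i)) _))
    (cong (λ l → (suc m C suc i) * (suc n C l) * F (suc i) l) (sym (+-∸-assoc 1 i≤k)))

mainTheorem5 : (p q : ℕ) → p ≥ 1 → q ≥ 1 →
    (HM₁ (completeWeakBipartite p q)
      ≡ sumFromTo 2 (p + q) (λ k → sumFromTo 1 (k ∸ 1) (λ i →
          (p C i) * (q C (k ∸ i))
          * (i * (2 ^ (p ∸ 1) * (2 ^ q ∸ 1)) + (k ∸ i) * (2 ^ (q ∸ 1) * (2 ^ p ∸ 1))) ^ 2)))
    × (HM₂ (completeWeakBipartite p q)
      ≡ sumFromTo 2 (p + q) (λ k → sumFromTo 1 (k ∸ 1) (λ i →
          (p C i) * (q C (k ∸ i))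
          * (2 ^ (p ∸ 1) * (2 ^ q ∸ 1)) ^ (2 * i)
          * (2 ^ (q ∸ 1) * (2 ^ p ∸ 1)) ^ (2 * (k ∸ i)))))
mainTheorem5 zero    _       ()
mainTheorem5 (suc _) zero    _  ()
mainTheorem5 p@(suc m) q@(suc n) _ _ =
    trans (sum-map-edges-by-type {p} {q} F₁ (λ a b → cong (_^ 2) (degree-sum a b)))
          (edgeTypeSum-antidiagonals m n F₁)
  , trans (sum-map-edges-by-type {p} {q} F₂ (λ a b →
             trans (cong (_^ 2) (degree-product a b))
                   ([x^i*y^j]^2≡x^[2i]*y^[2j] d₁ d₂ ∣ a ∣ ∣ b ∣)))
          (trans (edgeTypeSum-antidiagonals m n F₂)
                 (sumFromTo-cong 2 (p + q) (λ k → sumFromTo-cong 1 (k ∸ 1) (λ i →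
                   sym (*-assoc ((p C i) * (q C (k ∸ i))) (d₁ ^ (2 * i)) (d₂ ^ (2 * (k ∸ i))))))))
  where
  d₁ d₂ : ℕ
  d₁ = partDegree p q
  d₂ = partDegree q p
  F₁ F₂ : ℕ → ℕ → ℕ
  F₁ i j = (i * d₁ + j * d₂) ^ 2
  F₂ i j = d₁ ^ (2 * i) * d₂ ^ (2 * j)
  deg = degree (completeWeakBipartite p q)
  degree-sum : ∀ a b → sum (map deg (verticesOf (a Vec.++ b))) ≡ ∣ a ∣ * d₁ + ∣ b ∣ * d₂
  degree-sum = sum-map-verticesOf-++ (degree-↑ˡ {p} {q}) (degree-↑ʳ {p} {q})
  degree-product : ∀ a b → product (map deg (verticesOf (a Vec.++ b))) ≡ d₁ ^ ∣ a ∣ * d₂ ^ ∣ b ∣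
  degree-product = product-map-verticesOf-++ (degree-↑ˡ {p} {q}) (degree-↑ʳ {p} {q})
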